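{- Let $G$ be a 2-connected triangle-free graph of order $n$ that has an ear decomposition $G_0,G_1,\ldots,G_t$ in which every ear $P_i$ ($0\le i<t$) has at least one internal vertex. Then $mvd(G)\leq \left\lfloor \frac{n}{2}\right\rfloor$, and this bound is sharp.
   Context: An ear of a subgraph $H$ of $G$ is a path in $G$ whose two endpoints lie in $H$ and whose internal vertices and edges lie outside $H$. An ear decomposition of a 2-connected graph $G$ is a sequence of subgraphs $G_0\subset G_1\subset\cdots\subset G_t$ such that $G_0$ is a cycle of $G$, $G_{i+1}=G_i\cup P_i$ where $P_i$ is an ear of $G_i$ ($0\le i<t$), and $G_t=G$. For a vertex-coloring of $G$ (adjacent vertices may share colors), a vertex set is monochromatic if all its vertices have the same color; for distinct $x,y$, an $x$-$y$ vertex cut is a set $D\subseteq V(G)\setminus\{x,y\}$ with $x,y$ in different components of $G-D$. A coloring is an MVD-coloring if every two nonadjacent vertices have a monochromatic vertex cut separating them. $mvd(G)$ is the maximum number of colors used by an MVD-coloring of $G$. -}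

module Defs where

open import Data.Nat using (ℕ; zero; suc; _≤_; _<_)
open import Data.Fin using (Fin; toℕ)
open import Data.Fin.Subset using (Subset; _∈_; _∉_)
open import Data.Bool using (Bool; true; false)
open import Data.List using (List; []; _∷_; _++_; take; length; head; last; lookup)
open import Data.List.Membership.Propositional using () renaming (_∈_ to _∈ₗ_)
open import Data.List.Relation.Unary.All using (All)
open import Data.List.Relation.Unary.Any using (Any)
open import Data.List.Relation.Unary.Unique.Propositional using (Unique)
open import Data.Maybe using (Maybe; just)
open import Data.Product using (Σ; ∃; _×_; _,_)
open import Data.Sum using (_⊎_)
open import Data.Empty using (⊥)
open import Data.Unit using (⊤)
open import Relation.Nullary using (¬_)
open import Relation.Binary.PropositionalEquality using (_≡_; _≢_)

record Graph (n : ℕ) : Set where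
  field
    adj    : Fin n → Fin n → Bool
    sym    : ∀ x y → adj x y ≡ adj y x
    irrefl : ∀ x → adj x x ≡ false
open Graph public

module _ {n : ℕ} (G : Graph n) where

  Adj : Fin n → Fin n → Set
  Adj x y = adj G x y ≡ true

  Chain : List (Fin n) → Set
  Chain []             = ⊤
  Chain (x ∷ [])       = ⊤
  Chain (x ∷ y ∷ xs)   = Adj x y × Chain (y ∷ xs)

  IsPath : List (Fin n) → Set
  IsPath ps = Unique ps × Chain ps

  XYPath : Fin n → Fin n → List (Fin n) → Set
  XYPath x y ps = IsPath ps × head ps ≡ just x × last ps ≡ just y

  JoinedAvoiding : (Fin n → Set) → Fin n → Fin n → Set
  JoinedAvoiding S x y = ∃ λ ps → XYPath x y ps × All (λ v → ¬ S v) ps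

  ConnectedAvoiding : (Fin n → Set) → Set
  ConnectedAvoiding S = ∀ x y → ¬ S x → ¬ S y → JoinedAvoiding S x y

  TwoConnected : Set
  TwoConnected = 3 ≤ n × ConnectedAvoiding (λ _ → ⊥) × (∀ v → ConnectedAvoiding (λ u → u ≡ v))

  TriangleFree : Set
  TriangleFree = ∀ x y z → Adj x y → Adj y z → Adj x z → ⊥

EdgeOf : {n : ℕ} → List (Fin n) → Fin n → Fin n → Set
EdgeOf []           u v = ⊥
EdgeOf (x ∷ [])     u v = ⊥
EdgeOf (x ∷ y ∷ xs) u v = ((u ≡ x × v ≡ y) ⊎ (u ≡ y × v ≡ x)) ⊎ EdgeOf (y ∷ xs) u v

closeCycle : {n : ℕ} → List (Fin n) → List (Fin n)
closeCycle cs = cs ++ take 1 cs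

module _ {n : ℕ} (G : Graph n) where

  IsCycle : List (Fin n) → Set
  IsCycle cs = 3 ≤ length cs × Unique cs × Chain G (closeCycle cs)

  IsEar : (Fin n → Set) → (Fin n → Fin n → Set) → List (Fin n) → Set
  IsEar VH EH ps =
    IsPath G ps × 2 ≤ length ps
    × (∀ x → head ps ≡ just x → VH x)
    × (∀ x → last ps ≡ just x → VH x)
    × (∀ (i : Fin (length ps)) → 0 < toℕ i → suc (toℕ i) < length ps → ¬ VH (lookup ps i))
    × (∀ u v → EdgeOf ps u v → ¬ EH u v)

  -- An ear decomposition G₀ ⊂ G₁ ⊂ … ⊂ G_t: G₀ is the cycle `cycle`,
  -- G_{i+1} = G_i ∪ P_i where P_i = the i-th element of `ears`, and G_t = G.
  record EarDecomposition : Set where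
    field
      cycle : List (Fin n)
      ears  : List (List (Fin n))

    Vtx : ℕ → Fin n → Set
    Vtx i v = v ∈ₗ cycle ⊎ Any (λ p → v ∈ₗ p) (take i ears)

    Edg : ℕ → Fin n → Fin n → Set
    Edg i u v = EdgeOf (closeCycle cycle) u v ⊎ Any (λ p → EdgeOf p u v) (take i ears)

    field
      cycleOK   : IsCycle cycle
      earsOK    : ∀ (i : Fin (length ears)) → IsEar (Vtx (toℕ i)) (Edg (toℕ i)) (lookup ears i)
      allVtx    : ∀ v → Vtx (length ears) v
      allEdg    : ∀ u v → Adj G u v → Edg (length ears) u v
  open EarDecomposition public

  EarsHaveInternalVertex : EarDecomposition → Set
  EarsHaveInternalVertex D = ∀ (i : Fin (length (ears D))) → 3 ≤ length (lookup (ears D) i)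

  VertexCut : Subset n → Fin n → Fin n → Set
  VertexCut D x y = x ∉ D × y ∉ D × ¬ JoinedAvoiding G (λ v → v ∈ D) x y

  Monochromatic : {k : ℕ} → (Fin n → Fin k) → Subset n → Set
  Monochromatic c D = ∀ u v → u ∈ D → v ∈ D → c u ≡ c v

  IsMVDColoring : {k : ℕ} → (Fin n → Fin k) → Set
  IsMVDColoring c = ∀ x y → x ≢ y → ¬ Adj G x y → ∃ λ D → VertexCut D x y × Monochromatic c D

UsesAllColors : {n k : ℕ} → (Fin n → Fin k) → Set
UsesAllColors {n} {k} c = ∀ (j : Fin k) → ∃ λ v → c v ≡ j

Hyp : {n : ℕ} → Graph n → Set
Hyp G = TwoConnected G × TriangleFree G × ∃ λ (D : EarDecomposition G) → EarsHaveInternalVertex G D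

-- Upper bound: in a 2-connected triangle-free graph every colour class of an MVD-colouring has
-- at least two vertices, so at most n / 2 colours are used.  A vertex v has two neighbours u, w,
-- nonadjacent since there is no triangle; a monochromatic u-w cut must contain v (otherwise
-- u v w is a path), so it lies in the class of v, and it cannot be {v} because G - v is connected.
--
-- Sharpness: the cycle 0, 1, …, n - 1 is its own ear decomposition.  Colour i by i mod h with
-- h = ⌊n/2⌋.  For nonadjacent x and y some pair {p, p + h}, a single colour, splits the cycle
-- into the open arc from p to p + h and the rest, with x and y on different sides.

module Submission where

open import Defs
open import Data.Empty using (⊥; ⊥-elim)
open import Data.Fin using (Fin; zero; suc; toℕ; fromℕ; fromℕ<; _≟_; combine; remQuot)
open import Data.Fin.Properties
  using (any?; injective⇒≤; combine-remQuot; toℕ-fromℕ<; toℕ-fromℕ; toℕ≤pred[n]; toℕ<n; toℕ-injective)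
open import Data.Fin.Subset using (Subset; _∈_; _∉_; ⁅_⁆; _∪_)
open import Data.Fin.Subset.Properties using (_∈?_; x∈p∪q⁻; x∈p∪q⁺; x∈⁅y⁆⇒x≡y; x∈⁅x⁆)
open import Data.List using (List; []; _∷_; _++_; head; last; iterate)
open import Data.List.Membership.Propositional using () renaming (_∈_ to _∈ₗ_)
open import Data.List.Relation.Unary.All using (All; []; _∷_)
import Data.List.Relation.Unary.All as All
open import Data.List.Relation.Unary.All.Properties using (¬Any⇒All¬; ++⁺)
open import Data.List.Relation.Unary.AllPairs using ([]; _∷_)
open import Data.List.Relation.Unary.Any using (here; there)
open import Data.List.Relation.Unary.Unique.Propositional using (Unique)
open import Data.Maybe using (just)
open import Data.Nat
  using (ℕ; zero; suc; _+_; _*_; _∸_; _/_; _%_; _≤_; _<_; s≤s; z≤n; z<s; _≤?_; _<?_; NonZero; >-nonZero)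
open import Data.Nat.DivMod
  using (_mod_; m*n/n≡m; /-monoˡ-≤; m/n*n≤m; m%n<n; m<n⇒m%n≡m; [m+n]%n≡m%n)
import Data.Nat.GeneralisedArithmetic as ℕ
open import Data.Nat.Properties using () renaming (_≟_ to _≟ℕ_)
open import Data.Nat.Properties
  using (≤-refl; ≤-trans; ≤-antisym; ≤-total; ≤-pred; <-trans; ≤-<-trans; <-≤-trans; <⇒≤; <-irrefl;
         <-asym; <⇒≢; >⇒≢; <-cmp; n≮0; n<1+n; n≤1+n; ≮⇒≥; ≰⇒>; ≤∧≮⇒≡; ≤∧≢⇒<; m≤n⇒m<n∨m≡n;
         m≤n⇒∃[o]m+o≡n; m<m+n; m≤m+n; m≤n+m; +-suc; +-comm; +-identityʳ; *-comm; +-monoʳ-≤;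
         +-cancelʳ-≤; +-cancelʳ-<; m∸n+n≡m; suc-injective; m≢1+n+m; 1+n≢n)
open import Data.Product using (∃; ∃₂; _×_; _,_; proj₁; proj₂; uncurry)
open import Data.Sum using (_⊎_; inj₁; inj₂; swap; [_,_])
open import Data.Unit using (tt)
open import Function using (_∘_)
open import Relation.Binary.Definitions using (tri<; tri≈; tri>)
open import Relation.Binary.PropositionalEquality hiding (sym; [_])
import Relation.Binary.PropositionalEquality as ≡
open import Relation.Nullary using (¬_; Dec; yes; no; does)
open import Relation.Nullary.Decidable using (¬?; _×-dec_; _⊎-dec_; dec-true; dec-false)

∃-distinct-from₂ : ∀ {n} → 3 ≤ n → (a b : Fin n) → ∃ λ y → y ≢ a × y ≢ b
∃-distinct-from₂ (s≤s (s≤s (s≤s z≤n))) a b with zero ≟ a | zero ≟ b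
... | no 0≢a | no 0≢b = zero , 0≢a , 0≢b
... | yes refl | _ with suc zero ≟ b
...   | no 1≢b = suc zero , (λ ()) , 1≢b
...   | yes refl = suc (suc zero) , (λ ()) , (λ ())
∃-distinct-from₂ (s≤s (s≤s (s≤s z≤n))) a b | no _ | yes refl with suc zero ≟ a
...   | no 1≢a = suc zero , 1≢a , (λ ())
...   | yes refl = suc (suc zero) , (λ ()) , (λ ())

module _ {n : ℕ} (G : Graph n) where

  open import Data.List.Membership.DecPropositional (_≟_ {n}) using () renaming (_∈?_ to _∈ₗ?_)

  Adj-sym : ∀ {x y} → Adj G x y → Adj G y x
  Adj-sym {x} {y} a = trans (Graph.sym G y x) a

  Adj⇒≢ : ∀ {x y} → Adj G x y → x ≢ y
  Adj⇒≢ {x} a refl with trans (≡.sym (irrefl G x)) a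
  ... | ()

  Chain-++ : ∀ xs {y z} zs → Chain G xs → last xs ≡ just y → Adj G y z →
             Chain G (z ∷ zs) → Chain G (xs ++ z ∷ zs)
  Chain-++ (x ∷ []) zs _ refl a c = a , c
  Chain-++ (x ∷ x′ ∷ xs) zs (a′ , c′) e a c = a′ , Chain-++ (x′ ∷ xs) zs c′ e a c

  last-++ : ∀ (xs : List (Fin n)) z zs → last (xs ++ z ∷ zs) ≡ last (z ∷ zs)
  last-++ [] z zs = refl
  last-++ (x ∷ []) z zs = refl
  last-++ (x ∷ x′ ∷ xs) z zs = last-++ (x′ ∷ xs) z zs

  -- A walk may repeat vertices; `JoinedAvoiding` asks for a path.
  Walk : (Fin n → Set) → Fin n → Fin n → Set
  Walk S x y = ∃ λ ps → Chain G ps × head ps ≡ just x × last ps ≡ just y × All (¬_ ∘ S) ps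

  walk-++ : ∀ {S x y y′ z} → Walk S x y → Adj G y y′ → Walk S y′ z → Walk S x z
  walk-++ ([] , _ , () , _) _ _
  walk-++ (p ∷ ps , c , h , l , a) e (_ ∷ qs , c′ , refl , l′ , a′) =
    p ∷ ps ++ _ ∷ qs , Chain-++ (p ∷ ps) qs c l e c′ , h , trans (last-++ (p ∷ ps) _ qs) l′ , ++⁺ a a′

  walk-reverse : ∀ {S x y} → Walk S x y → Walk S y x
  walk-reverse ([] , _ , () , _)
  walk-reverse (x ∷ ps , c , refl , l , sx ∷ a) = go x ps c l sx a
    where
      go : ∀ {S y} x ps → Chain G (x ∷ ps) → last (x ∷ ps) ≡ just y → ¬ S x → All (¬_ ∘ S) ps →
           Walk S y x
      go x [] _ refl sx _ = x ∷ [] , tt , refl , refl , sx ∷ []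
      go x (x′ ∷ ps) (e , c) l sx (sx′ ∷ a) =
        walk-++ (go x′ ps c l sx′ a) (Adj-sym e) (x ∷ [] , tt , refl , refl , sx ∷ [])

  private
    dropTo : ∀ {x} (l : List (Fin n)) → x ∈ₗ l → List (Fin n)
    dropTo (y ∷ l) (here _) = y ∷ l
    dropTo (y ∷ l) (there p) = dropTo l p

    dropTo-head : ∀ {x} l (p : x ∈ₗ l) → head (dropTo l p) ≡ just x
    dropTo-head (y ∷ l) (here refl) = refl
    dropTo-head (y ∷ l) (there p) = dropTo-head l p

    dropTo-last : ∀ {x} l (p : x ∈ₗ l) → last (dropTo l p) ≡ last l
    dropTo-last (y ∷ l) (here _) = refl
    dropTo-last (y ∷ z ∷ l) (there p) = dropTo-last (z ∷ l) p

    dropTo-chain : ∀ {x} l (p : x ∈ₗ l) → Chain G l → Chain G (dropTo l p)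
    dropTo-chain (y ∷ l) (here _) c = c
    dropTo-chain (y ∷ z ∷ l) (there p) (_ , c) = dropTo-chain (z ∷ l) p c

    dropTo-unique : ∀ {x} l (p : x ∈ₗ l) → Unique l → Unique (dropTo l p)
    dropTo-unique (y ∷ l) (here _) u = u
    dropTo-unique (y ∷ l) (there p) (_ ∷ u) = dropTo-unique l p u

    dropTo-all : ∀ {P : Fin n → Set} {x} l (p : x ∈ₗ l) → All P l → All P (dropTo l p)
    dropTo-all (y ∷ l) (here _) a = a
    dropTo-all (y ∷ l) (there p) (_ ∷ a) = dropTo-all l p a

    cutAt : ∀ x (r : List (Fin n)) → Dec (x ∈ₗ r) → List (Fin n)
    cutAt x r (yes p) = dropTo r p
    cutAt x r (no _) = x ∷ r

    -- Prepending x to a path that already visits x closes a loop, which is cut out.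
    loopErase : List (Fin n) → List (Fin n)
    loopErase [] = []
    loopErase (x ∷ xs) = cutAt x (loopErase xs) (x ∈ₗ? loopErase xs)

    last-∷ : ∀ {x y : Fin n} r → head r ≡ just y → last (x ∷ r) ≡ last r
    last-∷ (_ ∷ _) _ = refl

    cutAt-head : ∀ x r d → head (cutAt x r d) ≡ just x
    cutAt-head x r (yes p) = dropTo-head r p
    cutAt-head x r (no _) = refl

    cutAt-last : ∀ {y} x r d → head r ≡ just y → last (cutAt x r d) ≡ last r
    cutAt-last x r (yes p) _ = dropTo-last r p
    cutAt-last x r (no _) h = last-∷ {x} r h

    cutAt-chain : ∀ {y} x r d → head r ≡ just y → Adj G x y → Chain G r → Chain G (cutAt x r d)
    cutAt-chain x r (yes p) _ _ c = dropTo-chain r p c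
    cutAt-chain x (_ ∷ _) (no _) refl a c = a , c

    loopErase-head : ∀ x xs → head (loopErase (x ∷ xs)) ≡ just x
    loopErase-head x xs = cutAt-head x _ (x ∈ₗ? loopErase xs)

    loopErase-last : ∀ l → last (loopErase l) ≡ last l
    loopErase-last [] = refl
    loopErase-last (x ∷ []) = refl
    loopErase-last (x ∷ y ∷ xs) =
      trans (cutAt-last x _ (x ∈ₗ? _) (loopErase-head y xs)) (loopErase-last (y ∷ xs))

    loopErase-chain : ∀ l → Chain G l → Chain G (loopErase l)
    loopErase-chain [] _ = tt
    loopErase-chain (x ∷ []) _ = tt
    loopErase-chain (x ∷ y ∷ xs) (a , c) =
      cutAt-chain x _ (x ∈ₗ? _) (loopErase-head y xs) a (loopErase-chain (y ∷ xs) c)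

    loopErase-unique : ∀ l → Unique (loopErase l)
    loopErase-unique [] = []
    loopErase-unique (x ∷ xs) with x ∈ₗ? loopErase xs
    ... | yes p = dropTo-unique _ p (loopErase-unique xs)
    ... | no x∉ = ¬Any⇒All¬ _ x∉ ∷ loopErase-unique xs

    loopErase-all : ∀ {P : Fin n → Set} l → All P l → All P (loopErase l)
    loopErase-all [] a = a
    loopErase-all (x ∷ xs) (px ∷ a) with x ∈ₗ? loopErase xs
    ... | yes p = dropTo-all _ p (loopErase-all xs a)
    ... | no _ = px ∷ loopErase-all xs a

  walk⇒joined : ∀ {S x y} → Walk S x y → JoinedAvoiding G S x y
  walk⇒joined ([] , _ , () , _)
  walk⇒joined (x ∷ xs , c , refl , l , a) =
    loopErase (x ∷ xs) ,
    ((loopErase-unique (x ∷ xs) , loopErase-chain _ c) ,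
     loopErase-head x xs , trans (loopErase-last (x ∷ xs)) l) ,
    loopErase-all _ a

  joined-sym : ∀ {S x y} → JoinedAvoiding G S x y → JoinedAvoiding G S y x
  joined-sym (ps , ((_ , c) , h , l) , a) = walk⇒joined (walk-reverse (ps , c , h , l , a))

  VertexCut-sym : ∀ {D x y} → VertexCut G D x y → VertexCut G D y x
  VertexCut-sym (x∉ , y∉ , ¬j) = y∉ , x∉ , ¬j ∘ joined-sym

  closed⇒¬joined : ∀ {S T : Fin n → Set} → (∀ z w → ¬ S z → ¬ S w → T z → Adj G z w → T w) →
                   ∀ {x y} → T x → ¬ T y → ¬ JoinedAvoiding G S x y
  closed⇒¬joined {S} {T} closed Tx ¬Ty (ps , ((_ , c) , h , l) , a) = ¬Ty (go ps c h l a Tx)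
    where
      go : ∀ ps {x y} → Chain G ps → head ps ≡ just x → last ps ≡ just y → All (¬_ ∘ S) ps → T x → T y
      go (z ∷ []) _ refl refl _ Tz = Tz
      go (z ∷ w ∷ ps) (e , c) refl l (sz ∷ sw ∷ a) Tz = go (w ∷ ps) c refl l (sw ∷ a) (closed z w sz sw Tz e)

  neighbourOnPath : ∀ {S : Fin n → Set} {v x ps} → XYPath G v x ps → All (¬_ ∘ S) ps → x ≢ v →
                    ∃ λ u → Adj G v u × ¬ S u
  neighbourOnPath {ps = _ ∷ []} (_ , refl , refl) _ x≢v = ⊥-elim (x≢v refl)
  neighbourOnPath {ps = _ ∷ u ∷ _} ((_ , e , _) , refl , _) (_ ∷ su ∷ _) _ = u , e , su

  twoNeighbours : TwoConnected G → ∀ v → ∃₂ λ u w → Adj G v u × Adj G v w × u ≢ w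
  twoNeighbours (n≥3 , connected , noCutVertex) v =
    let x , x≢v , _ = ∃-distinct-from₂ n≥3 v v
        ps , path , avoid = connected v x (λ ()) (λ ())
        u , vu , _ = neighbourOnPath {S = λ _ → ⊥} path avoid x≢v
        y , y≢v , y≢u = ∃-distinct-from₂ n≥3 v u
        qs , path′ , avoid′ = noCutVertex u v y (Adj⇒≢ vu) y≢u
        w , vw , w≢u = neighbourOnPath path′ avoid′ y≢v
    in u , w , vu , vw , w≢u ∘ ≡.sym

  module _ {k} {c : Fin n → Fin k} (2-conn : TwoConnected G) (△-free : TriangleFree G)
           (mvd : IsMVDColoring G c) where

    colourClass-nonSingleton : ∀ v → ¬ (∀ u → c u ≡ c v → u ≡ v)
    colourClass-nonSingleton v singleton
      with u , w , vu , vw , u≢w ← twoNeighbours 2-conn v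
      with D , (u∉D , w∉D , ¬joined) , mono ← mvd u w u≢w (△-free u v w (Adj-sym vu) vw)
      with v ∈? D
    ... | yes v∈D =
      let ps , path , avoid = proj₂ (proj₂ 2-conn) v u w (Adj⇒≢ vu ∘ ≡.sym) (Adj⇒≢ vw ∘ ≡.sym)
      in ¬joined (ps , path , All.map (λ z≢v z∈D → z≢v (singleton _ (mono _ _ z∈D v∈D))) avoid)
    ... | no v∉D = ¬joined (u ∷ v ∷ w ∷ [] , ((unique , chain) , refl , refl) , u∉D ∷ v∉D ∷ w∉D ∷ [])
      where
        unique : Unique (u ∷ v ∷ w ∷ [])
        unique = (Adj⇒≢ vu ∘ ≡.sym ∷ u≢w ∷ []) ∷ (Adj⇒≢ vw ∷ []) ∷ [] ∷ []
        chain : Chain G (u ∷ v ∷ w ∷ [])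
        chain = Adj-sym vu , vw , tt

    colourClass-∃-other : ∀ v → ∃ λ u → u ≢ v × c u ≡ c v
    colourClass-∃-other v with any? (λ u → ¬? (u ≟ v) ×-dec (c u ≟ c v))
    ... | yes found = found
    ... | no none = ⊥-elim (colourClass-nonSingleton v singleton)
      where
        singleton : ∀ u → c u ≡ c v → u ≡ v
        singleton u cu≡cv with u ≟ v
        ... | yes u≡v = u≡v
        ... | no u≢v = ⊥-elim (none (u , u≢v , cu≡cv))

nonSingletonFibres⇒*2≤ : ∀ {n k} (c : Fin n → Fin k) → UsesAllColors c →
                         (∀ v → ∃ λ u → u ≢ v × c u ≡ c v) → k * 2 ≤ n
nonSingletonFibres⇒*2≤ {n} {k} c surj other =
  injective⇒≤ {f = uncurry pick ∘ remQuot 2} (remQuot-injective ∘ pick-injective)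
  where
    pick : Fin k → Fin 2 → Fin n
    pick j zero = proj₁ (surj j)
    pick j (suc zero) = proj₁ (other (proj₁ (surj j)))

    c-pick : ∀ j i → c (pick j i) ≡ j
    c-pick j zero = proj₂ (surj j)
    c-pick j (suc zero) = trans (proj₂ (proj₂ (other _))) (proj₂ (surj j))

    pick-injective : ∀ {p q} → uncurry pick p ≡ uncurry pick q → p ≡ q
    pick-injective {j , i} {j′ , i′} e
      with refl ← trans (≡.sym (c-pick j i)) (trans (cong c e) (c-pick j′ i′)) = cong (j ,_) (same i i′ e)
      where
        same : ∀ i i′ → pick j i ≡ pick j i′ → i ≡ i′
        same zero zero _ = refl
        same zero (suc zero) e = ⊥-elim (proj₁ (proj₂ (other _)) (≡.sym e))
        same (suc zero) zero e = ⊥-elim (proj₁ (proj₂ (other _)) e)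
        same (suc zero) (suc zero) _ = refl

    remQuot-injective : ∀ {i i′ : Fin (k * 2)} → remQuot {k} 2 i ≡ remQuot 2 i′ → i ≡ i′
    remQuot-injective {i} {i′} e =
      trans (≡.sym (combine-remQuot {k} 2 i)) (trans (cong (uncurry combine) e) (combine-remQuot {k} 2 i′))

mvd-upperBound : ∀ {n} (G : Graph n) → TwoConnected G → TriangleFree G →
                 ∀ {k} (c : Fin n → Fin k) → UsesAllColors c → IsMVDColoring G c → k ≤ n / 2
mvd-upperBound {n} G 2-conn △-free {k} c surj mvd = begin
  k          ≡⟨ ≡.sym (m*n/n≡m k 2) ⟩
  k * 2 / 2  ≤⟨ /-monoˡ-≤ 2 (nonSingletonFibres⇒*2≤ c surj (colourClass-∃-other G 2-conn △-free mvd)) ⟩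
  n / 2      ∎
  where open Data.Nat.Properties.≤-Reasoning

module _ {n : ℕ} (R : Fin n → Fin n → Set) (R? : ∀ x y → Dec (R x y))
         (R-sym : ∀ {x y} → R x y → R y x) (R-irrefl : ∀ {x} → ¬ R x x) where

  relationGraph : Graph n
  relationGraph = record
    { adj = λ x y → does (R? x y)
    ; sym = adj-sym
    ; irrefl = λ x → dec-false (R? x x) R-irrefl
    }
    where
      adj-sym : ∀ x y → does (R? x y) ≡ does (R? y x)
      adj-sym x y with R? x y | R? y x
      ... | yes _ | yes _ = refl
      ... | no _ | no _ = refl
      ... | yes r | no ¬r = ⊥-elim (¬r (R-sym r))
      ... | no ¬r | yes r = ⊥-elim (¬r (R-sym r))

  Adj⇒R : ∀ {x y} → Adj relationGraph x y → R x y
  Adj⇒R {x} {y} a with R? x y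
  ... | yes r = r

  R⇒Adj : ∀ {x y} → R x y → Adj relationGraph x y
  R⇒Adj {x} {y} = dec-true (R? x y)

module _ {A : Set} (f : A → A) where

  FunctionEdge : A → A → Set
  FunctionEdge x y = y ≡ f x ⊎ x ≡ f y

  -- Of the three edges of a triangle, two leave or two enter the same vertex (impossible for an
  -- injective function without fixed points), unless they form a 3-cycle of f.
  functionGraph-triangleFree : (∀ {x y} → f x ≡ f y → x ≡ y) → (∀ x → f x ≢ x) → (∀ x → f (f (f x)) ≢ x) →
                               ∀ {x y z} → FunctionEdge x y → FunctionEdge y z → FunctionEdge x z → ⊥
  functionGraph-triangleFree inj fix≢ 3-cycle≢ = triangle
    where
      loop : ∀ {x y} → x ≡ y → ¬ FunctionEdge x y
      loop refl (inj₁ e) = fix≢ _ (≡.sym e)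
      loop refl (inj₂ e) = fix≢ _ (≡.sym e)

      triangle : ∀ {x y z} → FunctionEdge x y → FunctionEdge y z → FunctionEdge x z → ⊥
      triangle (inj₁ refl) (inj₁ refl) (inj₁ e) = fix≢ _ (inj e)
      triangle (inj₁ refl) (inj₁ refl) (inj₂ e) = 3-cycle≢ _ (≡.sym e)
      triangle (inj₁ refl) (inj₂ e) r = loop (inj e) r
      triangle (inj₂ refl) (inj₁ e) r = loop (≡.sym e) r
      triangle (inj₂ refl) (inj₂ refl) (inj₁ e) = 3-cycle≢ _ (≡.sym e)
      triangle (inj₂ refl) (inj₂ refl) (inj₂ e) = fix≢ _ (inj e)

  last-iterate : ∀ x k → last (iterate f x (suc k)) ≡ just (ℕ.iterate f x k)
  last-iterate x zero = refl
  last-iterate x (suc k) = last-iterate (f x) k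

  iterate-snoc : ∀ x k → iterate f x (suc k) ≡ iterate f x k ++ ℕ.iterate f x k ∷ []
  iterate-snoc x zero = refl
  iterate-snoc x (suc k) = cong (x ∷_) (iterate-snoc (f x) k)

  ℕ-iterate-suc : ∀ x k → ℕ.iterate f x (suc k) ≡ f (ℕ.iterate f x k)
  ℕ-iterate-suc x zero = refl
  ℕ-iterate-suc x (suc k) = ℕ-iterate-suc (f x) k

module _ {n : ℕ} (f : Fin n → Fin n) where

  iterate-edge : ∀ {u} x k → u ∈ₗ iterate f x k → EdgeOf (iterate f x (suc k)) u (f u)
  iterate-edge x (suc k) (here refl) = inj₁ (inj₁ (refl , refl))
  iterate-edge x (suc k) (there u∈) = inj₂ (iterate-edge (f x) k u∈)

  iterate-chain : ∀ (G : Graph n) → (∀ z → Adj G z (f z)) → ∀ x k → Chain G (iterate f x k)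
  iterate-chain G step x zero = tt
  iterate-chain G step x (suc zero) = tt
  iterate-chain G step x (suc (suc k)) = step x , iterate-chain G step (f x) (suc k)

EdgeOf-sym : ∀ {n} (l : List (Fin n)) {u v} → EdgeOf l u v → EdgeOf l v u
EdgeOf-sym (x ∷ y ∷ l) (inj₁ (inj₁ (u≡x , v≡y))) = inj₁ (inj₂ (v≡y , u≡x))
EdgeOf-sym (x ∷ y ∷ l) (inj₁ (inj₂ (u≡y , v≡x))) = inj₁ (inj₁ (v≡x , u≡y))
EdgeOf-sym (x ∷ y ∷ l) (inj₂ e) = inj₂ (EdgeOf-sym (y ∷ l) e)

InWindow : ℕ → ℕ → ℕ → Set
InWindow h p c = p < c × c < p + h

OutsideWindow : ℕ → ℕ → ℕ → Set
OutsideWindow h p c = c < p ⊎ p + h < c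

private
  1+c<c+h : ∀ {h} → 2 ≤ h → ∀ c → suc c < c + h
  1+c<c+h {h} 2≤h c = subst (_≤ c + h) (+-comm c 2) (+-monoʳ-≤ c 2≤h)

  windowEnd≡1+c⇒start<c : ∀ {h p c} → 2 ≤ h → p + h ≡ suc c → p < c
  windowEnd≡1+c⇒start<c {h} {p} {c} 2≤h e = +-cancelʳ-< h p c (subst (_< c + h) (≡.sym e) (1+c<c+h 2≤h c))

  windowEndingAt : ∀ {h t} → h ≤ t → ∃ λ p → p + h ≡ t
  windowEndingAt h≤t = _ , m∸n+n≡m h≤t

-- The pair (a, b) = (0, N - 1) has to be excluded: on the cycle it is an edge.
separatingWindow : ∀ {h N a b} → 2 ≤ h → h + h ≤ N → suc a < b → b < N → (a ≡ 0 → suc b ≢ N) →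
  ∃ λ p → p + h < N × (InWindow h p a × OutsideWindow h p b ⊎ InWindow h p b × OutsideWindow h p a)
separatingWindow {h} {N} {a} {b} 2≤h h+h≤N a+1<b b<N not-0-and-last with b ≤? a + h
... | yes b≤a+h with suc a + h <? N
...   | yes a+1+h<N = suc a , a+1+h<N , inj₂ ((a+1<b , s≤s b≤a+h) , inj₁ (n<1+n a))
...   | no a+1+h≮N
  with p , p+h≡a+1 ← windowEndingAt (+-cancelʳ-≤ h h (suc a) (≤-trans h+h≤N (≮⇒≥ a+1+h≮N))) =
  p , subst (_< N) (≡.sym p+h≡a+1) (<-trans a+1<b b<N) ,
  inj₁ ((windowEnd≡1+c⇒start<c 2≤h p+h≡a+1 , subst (a <_) (≡.sym p+h≡a+1) (n<1+n a)) ,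
        inj₂ (subst (_< b) (≡.sym p+h≡a+1) a+1<b))
separatingWindow {h} {N} {a} {b} 2≤h h+h≤N a+1<b b<N not-0-and-last | no b≰a+h with suc b <? N
...   | yes b+1<N
  with p , p+h≡b+1 ← windowEndingAt (≤-trans (m≤n+m h a) (<⇒≤ (<-trans (≰⇒> b≰a+h) (n<1+n b)))) =
  p , subst (_< N) (≡.sym p+h≡b+1) b+1<N ,
  inj₂ ((windowEnd≡1+c⇒start<c 2≤h p+h≡b+1 , subst (b <_) (≡.sym p+h≡b+1) (n<1+n b)) ,
        inj₁ (+-cancelʳ-< h a p (subst (a + h <_) (≡.sym p+h≡b+1) (<-trans (≰⇒> b≰a+h) (n<1+n b)))))
...   | no b+1≮N with a
...     | zero = ⊥-elim (not-0-and-last refl (≤∧≮⇒≡ b<N b+1≮N))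
...     | suc a′ = a′ , ≤-<-trans (n≤1+n (a′ + h)) (<-trans (≰⇒> b≰a+h) b<N) ,
                   inj₁ ((n<1+n a′ , 1+c<c+h 2≤h a′) , inj₂ (≤-<-trans (n≤1+n (a′ + h)) (≰⇒> b≰a+h)))

module Cycle (m : ℕ) where

  N : ℕ
  N = suc (suc (suc (suc m)))

  opaque
    succ : Fin N → Fin N
    succ i with suc (toℕ i) <? N
    ... | yes i+1<N = fromℕ< i+1<N
    ... | no _ = zero

    toℕ-succ : ∀ i → suc (toℕ i) < N → toℕ (succ i) ≡ suc (toℕ i)
    toℕ-succ i i+1<N with suc (toℕ i) <? N
    ... | yes i+1<N = toℕ-fromℕ< i+1<N
    ... | no i+1≮N = ⊥-elim (i+1≮N i+1<N)

    toℕ-succ-last : ∀ i → suc (toℕ i) ≡ N → toℕ (succ i) ≡ 0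
    toℕ-succ-last i i+1≡N with suc (toℕ i) <? N
    ... | yes i+1<N = ⊥-elim (<-irrefl i+1≡N i+1<N)
    ... | no _ = refl

  SuccStep : ℕ → ℕ → Set
  SuccStep a b = suc a < N × b ≡ suc a ⊎ suc a ≡ N × b ≡ 0

  succStep : ∀ i → SuccStep (toℕ i) (toℕ (succ i))
  succStep i with m≤n⇒m<n∨m≡n (toℕ<n i)
  ... | inj₁ i+1<N = inj₁ (i+1<N , toℕ-succ i i+1<N)
  ... | inj₂ i+1≡N = inj₂ (i+1≡N , toℕ-succ-last i i+1≡N)

  succ-injective : ∀ {i j} → succ i ≡ succ j → i ≡ j
  succ-injective {i} {j} e with succStep i | succStep j | cong toℕ e
  ... | inj₁ (_ , si) | inj₁ (_ , sj) | e′ = toℕ-injective (suc-injective (trans (≡.sym si) (trans e′ sj)))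
  ... | inj₂ (i+1≡N , _) | inj₂ (j+1≡N , _) | _ = toℕ-injective (suc-injective (trans i+1≡N (≡.sym j+1≡N)))
  ... | inj₁ (_ , si) | inj₂ (_ , sj) | e′ with () ← trans (≡.sym si) (trans e′ sj)
  ... | inj₂ (_ , si) | inj₁ (_ , sj) | e′ with () ← trans (≡.sym si) (trans e′ sj)

  -- At most one of three consecutive steps wraps around, and N ≠ 3.
  3steps≢ : ∀ {a₀ a₁ a₂ a₃} → SuccStep a₀ a₁ → SuccStep a₁ a₂ → SuccStep a₂ a₃ → a₃ ≢ a₀
  3steps≢ (inj₁ (_ , refl)) (inj₁ (_ , refl)) (inj₁ (_ , refl)) e = m≢1+n+m _ {2} (≡.sym e)
  3steps≢ (inj₁ (_ , refl)) (inj₁ (_ , refl)) (inj₂ (refl , refl)) ()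
  3steps≢ (inj₁ (_ , refl)) (inj₂ (refl , refl)) (inj₁ (_ , refl)) ()
  3steps≢ (inj₁ (_ , refl)) (inj₂ (refl , refl)) (inj₂ (() , _))
  3steps≢ (inj₂ (refl , refl)) (inj₁ (_ , refl)) (inj₁ (_ , refl)) ()
  3steps≢ (inj₂ (refl , refl)) (inj₁ (_ , refl)) (inj₂ (() , _))
  3steps≢ (inj₂ (refl , refl)) (inj₂ (() , _)) _

  succ³≢id : ∀ i → succ (succ (succ i)) ≢ i
  succ³≢id i e = 3steps≢ (succStep i) (succStep (succ i)) (succStep (succ (succ i))) (cong toℕ e)

  succ≢id : ∀ i → succ i ≢ i
  succ≢id i e with succStep i | cong toℕ e
  ... | inj₁ (_ , si) | e′ = 1+n≢n (trans (≡.sym si) e′)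
  ... | inj₂ (i+1≡N , si) | e′ with () ← trans (≡.sym (cong suc (trans (≡.sym e′) si))) i+1≡N

  CycleEdge : Fin N → Fin N → Set
  CycleEdge = FunctionEdge succ

  cycleEdge? : ∀ x y → Dec (CycleEdge x y)
  cycleEdge? x y = (y ≟ succ x) ⊎-dec (x ≟ succ y)

  cycleEdge-irrefl : ∀ {x} → ¬ CycleEdge x x
  cycleEdge-irrefl {x} (inj₁ e) = succ≢id x (≡.sym e)
  cycleEdge-irrefl {x} (inj₂ e) = succ≢id x (≡.sym e)

  opaque
    C : Graph N
    C = relationGraph CycleEdge cycleEdge? swap cycleEdge-irrefl

    Adj⇒CycleEdge : ∀ {x y} → Adj C x y → CycleEdge x y
    Adj⇒CycleEdge = Adj⇒R CycleEdge cycleEdge? swap cycleEdge-irrefl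

    Adj-succ : ∀ x → Adj C x (succ x)
    Adj-succ x = R⇒Adj CycleEdge cycleEdge? swap cycleEdge-irrefl (inj₁ refl)

  C-triangleFree : TriangleFree C
  C-triangleFree x y z xy yz xz = functionGraph-triangleFree succ succ-injective succ≢id succ³≢id
    (Adj⇒CycleEdge xy) (Adj⇒CycleEdge yz) (Adj⇒CycleEdge xz)

  arc : Fin N → ℕ → List (Fin N)
  arc x k = iterate succ x (suc k)

  toℕ-succ-inArc : ∀ x k → toℕ x + suc k < N → toℕ (succ x) ≡ suc (toℕ x)
  toℕ-succ-inArc x k lt = toℕ-succ x (≤-<-trans (m<m+n (toℕ x) z<s) lt)

  succ-shiftsArc : ∀ x k → toℕ x + suc k < N → toℕ (succ x) + k ≡ toℕ x + suc k
  succ-shiftsArc x k lt = trans (cong (_+ k) (toℕ-succ-inArc x k lt)) (≡.sym (+-suc (toℕ x) k))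

  toℕ-iterate-succ : ∀ x k → toℕ x + k < N → toℕ (ℕ.iterate succ x k) ≡ toℕ x + k
  toℕ-iterate-succ x zero _ = ≡.sym (+-identityʳ (toℕ x))
  toℕ-iterate-succ x (suc k) lt = trans (toℕ-iterate-succ (succ x) k (subst (_< N) (≡.sym e) lt)) e
    where e = succ-shiftsArc x k lt

  arc-bounds : ∀ x k → toℕ x + k < N → All (λ z → toℕ x ≤ toℕ z × toℕ z ≤ toℕ x + k) (arc x k)
  arc-bounds x zero _ = (≤-refl , m≤m+n (toℕ x) 0) ∷ []
  arc-bounds x (suc k) lt = (≤-refl , m≤m+n (toℕ x) (suc k)) ∷
    All.map (λ {z} (l , u) → ≤-trans (n≤1+n (toℕ x)) (subst (_≤ toℕ z) (toℕ-succ-inArc x k lt) l) ,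
                             subst (toℕ z ≤_) e u)
            (arc-bounds (succ x) k (subst (_< N) (≡.sym e) lt))
    where e = succ-shiftsArc x k lt

  arc-unique : ∀ x k → toℕ x + k < N → Unique (arc x k)
  arc-unique x zero _ = [] ∷ []
  arc-unique x (suc k) lt =
    All.map (λ (l , _) x≡z → <-irrefl (cong toℕ x≡z) (subst (_≤ _) (toℕ-succ-inArc x k lt) l))
            (arc-bounds (succ x) k lt′) ∷ arc-unique (succ x) k lt′
    where lt′ = subst (_< N) (≡.sym (succ-shiftsArc x k lt)) lt

  arc-∋ : ∀ {v} x k → toℕ x + k < N → toℕ x ≤ toℕ v → toℕ v ≤ toℕ x + k → v ∈ₗ arc x k
  arc-∋ x zero _ l u = here (toℕ-injective (≤-antisym (subst (_ ≤_) (+-identityʳ (toℕ x)) u) l))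
  arc-∋ {v} x (suc k) lt l u with toℕ v ≟ℕ toℕ x
  ... | yes v≡x = here (toℕ-injective v≡x)
  ... | no v≢x = there (arc-∋ (succ x) k (subst (_< N) (≡.sym e) lt)
                          (subst (_≤ toℕ v) (≡.sym (toℕ-succ-inArc x k lt)) (≤∧≢⇒< l (v≢x ∘ ≡.sym)))
                          (subst (toℕ v ≤_) (≡.sym e) u))
    where e = succ-shiftsArc x k lt

  arcWalk : ∀ {S} x {y} k → toℕ x + k ≡ toℕ y → (∀ z → toℕ x ≤ toℕ z → toℕ z ≤ toℕ y → ¬ S z) → Walk C S x y
  arcWalk x {y} k x+k≡y avoid =
    arc x k , iterate-chain succ C Adj-succ x (suc k) , refl ,
    trans (last-iterate succ x k) (cong just (toℕ-injective (trans (toℕ-iterate-succ x k lt) x+k≡y))) ,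
    All.map (λ {z} (l , u) → avoid z l (subst (toℕ z ≤_) x+k≡y u)) (arc-bounds x k lt)
    where lt = subst (_< N) (≡.sym x+k≡y) (toℕ<n y)

  forwardWalk : ∀ {S x y} → toℕ x ≤ toℕ y → (∀ z → toℕ x ≤ toℕ z → toℕ z ≤ toℕ y → ¬ S z) → Walk C S x y
  forwardWalk {x = x} x≤y = arcWalk x _ (proj₂ (m≤n⇒∃[o]m+o≡n x≤y))

  forward⇒connectedAvoiding : ∀ {S} → (∀ x y → ¬ S x → ¬ S y → toℕ x ≤ toℕ y → Walk C S x y) →
                                 ConnectedAvoiding C S
  forward⇒connectedAvoiding forward x y ¬Sx ¬Sy with ≤-total (toℕ x) (toℕ y)
  ... | inj₁ x≤y = walk⇒joined C (forward x y ¬Sx ¬Sy x≤y)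
  ... | inj₂ y≤x = walk⇒joined C (walk-reverse C (forward y x ¬Sy ¬Sx y≤x))

  K : ℕ
  K = suc (suc (suc m))

  top : Fin N
  top = fromℕ K

  succ-top : succ top ≡ zero
  succ-top = toℕ-injective (toℕ-succ-last top (cong suc (toℕ-fromℕ K)))

  ≤top : ∀ (i : Fin N) → toℕ i ≤ toℕ top
  ≤top i = subst (toℕ i ≤_) (≡.sym (toℕ-fromℕ K)) (toℕ≤pred[n] i)

  C-connected : ConnectedAvoiding C (λ _ → ⊥)
  C-connected = forward⇒connectedAvoiding (λ _ _ _ _ x≤y → forwardWalk x≤y (λ _ _ _ ()))

  -- If v lies between x and y, go from y up to the top vertex, across the edge top — 0,
  -- and up to x; then reverse.
  C-noCutVertex : ∀ v → ConnectedAvoiding C (_≡ v)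
  C-noCutVertex v = forward⇒connectedAvoiding around
    where
      around : ∀ x y → x ≢ v → y ≢ v → toℕ x ≤ toℕ y → Walk C (_≡ v) x y
      around x y x≢v y≢v x≤y with toℕ x ≤? toℕ v | toℕ v ≤? toℕ y
      ... | no x≰v | _ = forwardWalk x≤y (λ { z l _ refl → x≰v l })
      ... | yes _ | no v≰y = forwardWalk x≤y (λ { z _ u refl → v≰y u })
      ... | yes x≤v | yes v≤y = walk-reverse C (walk-++ C
        (forwardWalk (≤top y) (λ { z l _ refl → y≢v (toℕ-injective (≤-antisym l v≤y)) }))
        (subst (Adj C top) succ-top (Adj-succ top))
        (forwardWalk z≤n (λ { z _ u refl → x≢v (toℕ-injective (≤-antisym x≤v u)) })))

  cycleList : List (Fin N)
  cycleList = arc zero K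

  cycleList-∋ : ∀ v → v ∈ₗ cycleList
  cycleList-∋ v = arc-∋ zero K ≤-refl z≤n (toℕ≤pred[n] v)

  closeCycle-cycleList : closeCycle cycleList ≡ iterate succ zero (suc N)
  closeCycle-cycleList = begin
    cycleList ++ zero ∷ []                          ≡⟨ cong (λ z → cycleList ++ z ∷ []) (≡.sym wrap) ⟩
    cycleList ++ ℕ.iterate succ zero N ∷ []         ≡⟨ ≡.sym (iterate-snoc succ zero N) ⟩
    iterate succ zero (suc N)                       ∎
    where
      open ≡-Reasoning
      reaches-top : toℕ (ℕ.iterate succ zero K) ≡ toℕ top
      reaches-top = trans (toℕ-iterate-succ zero K ≤-refl) (≡.sym (toℕ-fromℕ K))
      wrap : ℕ.iterate succ zero N ≡ zero
      wrap = begin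
        ℕ.iterate succ zero (suc K)   ≡⟨ ℕ-iterate-suc succ zero K ⟩
        succ (ℕ.iterate succ zero K)  ≡⟨ cong succ (toℕ-injective reaches-top) ⟩
        succ top                      ≡⟨ succ-top ⟩
        zero                          ∎

  succ-edge : ∀ u → EdgeOf (closeCycle cycleList) u (succ u)
  succ-edge u = subst (λ l → EdgeOf l u (succ u)) (≡.sym closeCycle-cycleList)
                      (iterate-edge succ zero N (cycleList-∋ u))

  cycleList-edges : ∀ {u v} → Adj C u v → EdgeOf (closeCycle cycleList) u v
  cycleList-edges a with Adj⇒CycleEdge a
  ... | inj₁ refl = succ-edge _
  ... | inj₂ refl = EdgeOf-sym (closeCycle cycleList) (succ-edge _)

  earDecomposition : EarDecomposition C
  earDecomposition = record
    { cycle = cycleList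
    ; ears = []
    ; cycleOK = s≤s (s≤s (s≤s z≤n)) , arc-unique zero K ≤-refl ,
                subst (Chain C) (≡.sym closeCycle-cycleList) (iterate-chain succ C Adj-succ zero (suc N))
    ; earsOK = λ ()
    ; allVtx = λ v → inj₁ (cycleList-∋ v)
    ; allEdg = λ u v a → inj₁ (cycleList-edges a)
    }

  C-hyp : Hyp C
  C-hyp = (s≤s (s≤s (s≤s z≤n)) , C-connected , C-noCutVertex) , C-triangleFree , earDecomposition , λ ()

  h : ℕ
  h = N / 2

  2≤h : 2 ≤ h
  2≤h = /-monoˡ-≤ 2 4≤N
    where
      4≤N : 4 ≤ N
      4≤N = s≤s (s≤s (s≤s (s≤s z≤n)))

  instance
    h-nonZero : NonZero h
    h-nonZero = >-nonZero (≤-trans (s≤s z≤n) 2≤h)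

  h+h≤N : h + h ≤ N
  h+h≤N = subst (_≤ N) (trans (*-comm h 2) (cong (h +_) (+-identityʳ h))) (m/n*n≤m N 2)

  colour : Fin N → Fin h
  colour v = toℕ v mod h

  toℕ-colour : ∀ v → toℕ (colour v) ≡ toℕ v % h
  toℕ-colour v = toℕ-fromℕ< (m%n<n (toℕ v) h)

  colour-surjective : UsesAllColors colour
  colour-surjective j = fromℕ< j<N , toℕ-injective (begin
    toℕ (colour (fromℕ< j<N)) ≡⟨ toℕ-colour _ ⟩
    toℕ (fromℕ< j<N) % h      ≡⟨ cong (_% h) (toℕ-fromℕ< j<N) ⟩
    toℕ j % h                 ≡⟨ m<n⇒m%n≡m (toℕ<n j) ⟩
    toℕ j                     ∎)
    where
      open ≡-Reasoning
      j<N = <-≤-trans (toℕ<n j) (≤-trans (m≤m+n h h) h+h≤N)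

  module Window (p : ℕ) (p+h<N : p + h < N) where

    p<N : p < N
    p<N = ≤-<-trans (m≤m+n p h) p+h<N

    ends : Subset N
    ends = ⁅ fromℕ< p<N ⁆ ∪ ⁅ fromℕ< p+h<N ⁆

    ∈ends : ∀ {z} → z ∈ ends → toℕ z ≡ p ⊎ toℕ z ≡ p + h
    ∈ends {z} z∈ with x∈p∪q⁻ ⁅ fromℕ< p<N ⁆ ⁅ fromℕ< p+h<N ⁆ z∈
    ... | inj₁ z∈₁ = inj₁ (trans (cong toℕ (x∈⁅y⁆⇒x≡y _ z∈₁)) (toℕ-fromℕ< p<N))
    ... | inj₂ z∈₂ = inj₂ (trans (cong toℕ (x∈⁅y⁆⇒x≡y _ z∈₂)) (toℕ-fromℕ< p+h<N))

    ≡p⇒∈ends : ∀ {z} → toℕ z ≡ p → z ∈ ends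
    ≡p⇒∈ends e = x∈p∪q⁺ (inj₁ (subst (_∈ _) (toℕ-injective (trans (toℕ-fromℕ< p<N) (≡.sym e))) (x∈⁅x⁆ _)))

    ≡p+h⇒∈ends : ∀ {z} → toℕ z ≡ p + h → z ∈ ends
    ≡p+h⇒∈ends e = x∈p∪q⁺ (inj₂ (subst (_∈ _) (toℕ-injective (trans (toℕ-fromℕ< p+h<N) (≡.sym e))) (x∈⁅x⁆ _)))

    ≢ends⇒∉ : ∀ {z} → toℕ z ≢ p → toℕ z ≢ p + h → z ∉ ends
    ≢ends⇒∉ ≢p ≢p+h z∈ = [ ≢p , ≢p+h ] (∈ends z∈)

    inside⇒∉ends : ∀ {z} → InWindow h p (toℕ z) → z ∉ ends
    inside⇒∉ends (p<z , z<p+h) = ≢ends⇒∉ (>⇒≢ p<z) (<⇒≢ z<p+h)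

    outside⇒∉ends : ∀ {z} → OutsideWindow h p (toℕ z) → z ∉ ends
    outside⇒∉ends (inj₁ z<p) = ≢ends⇒∉ (<⇒≢ z<p) (<⇒≢ (<-≤-trans z<p (m≤m+n p h)))
    outside⇒∉ends (inj₂ p+h<z) = ≢ends⇒∉ (>⇒≢ (≤-<-trans (m≤m+n p h) p+h<z)) (>⇒≢ p+h<z)

    outside⇒¬inside : ∀ {c} → OutsideWindow h p c → ¬ InWindow h p c
    outside⇒¬inside (inj₁ c<p) (p<c , _) = <-asym c<p p<c
    outside⇒¬inside (inj₂ p+h<c) (_ , c<p+h) = <-asym c<p+h p+h<c

    ends-monochromatic : Monochromatic C colour ends
    ends-monochromatic u v u∈ v∈ = toℕ-injective (trans (colour≡ u∈) (≡.sym (colour≡ v∈)))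
      where
        colour≡ : ∀ {z} → z ∈ ends → toℕ (colour z) ≡ p % h
        colour≡ {z} z∈ with ∈ends z∈
        ... | inj₁ z≡p = trans (toℕ-colour z) (cong (_% h) z≡p)
        ... | inj₂ z≡p+h = trans (toℕ-colour z) (trans (cong (_% h) z≡p+h) ([m+n]%n≡m%n p h))

    -- The only edges leaving the window end at p or p + h; the wrap-around edge top — 0 lies
    -- outside it because p + h < N.
    window-closed : ∀ z w → z ∉ ends → w ∉ ends → InWindow h p (toℕ z) → Adj C z w → InWindow h p (toℕ w)
    window-closed z w _ w∉ (p<z , z<p+h) a with Adj⇒CycleEdge a
    ... | inj₁ refl =
      let w≡z+1 = toℕ-succ z (≤-<-trans z<p+h p+h<N)
      in  <-trans p<z (subst (suc (toℕ z) ≤_) (≡.sym w≡z+1) ≤-refl) ,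
          ≤∧≢⇒< (subst (_≤ p + h) (≡.sym w≡z+1) z<p+h) (λ w≡p+h → w∉ (≡p+h⇒∈ends w≡p+h))
    ... | inj₂ refl with succStep w
    ...   | inj₁ (_ , z≡w+1) =
      ≤∧≢⇒< (≤-pred (subst (p <_) z≡w+1 p<z)) (λ p≡w → w∉ (≡p⇒∈ends (≡.sym p≡w))) ,
      <-trans (n<1+n (toℕ w)) (subst (_< p + h) z≡w+1 z<p+h)
    ...   | inj₂ (_ , z≡0) = ⊥-elim (n≮0 (subst (p <_) z≡0 p<z))

    ends-separate : ∀ {u w} → InWindow h p (toℕ u) → OutsideWindow h p (toℕ w) → VertexCut C ends u w
    ends-separate inside outside =
      inside⇒∉ends inside , outside⇒∉ends outside ,
      closed⇒¬joined C {T = InWindow h p ∘ toℕ} window-closed inside (outside⇒¬inside outside)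

    ends-monochromaticCut : ∀ {x y} →
      InWindow h p (toℕ x) × OutsideWindow h p (toℕ y) ⊎ InWindow h p (toℕ y) × OutsideWindow h p (toℕ x) →
      ∃ λ D → VertexCut C D x y × Monochromatic C colour D
    ends-monochromaticCut (inj₁ (x-in , y-out)) = ends , ends-separate x-in y-out , ends-monochromatic
    ends-monochromaticCut (inj₂ (y-in , x-out)) =
      ends , VertexCut-sym C (ends-separate y-in x-out) , ends-monochromatic

  nonadjacent⇒gap : ∀ {x y} → toℕ x < toℕ y → ¬ Adj C x y → suc (toℕ x) < toℕ y
  nonadjacent⇒gap {x} {y} x<y ¬xy = ≤∧≢⇒< x<y λ x+1≡y →
    let succ-x≡y = toℕ-injective (trans (toℕ-succ x (subst (_< N) (≡.sym x+1≡y) (toℕ<n y))) x+1≡y)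
    in ¬xy (subst (Adj C x) succ-x≡y (Adj-succ x))

  nonadjacent⇒¬first-top : ∀ {x y} → ¬ Adj C x y → toℕ x ≡ 0 → suc (toℕ y) ≢ N
  nonadjacent⇒¬first-top {x} {y} ¬xy x≡0 y+1≡N =
    let succ-y≡x = toℕ-injective (trans (toℕ-succ-last y y+1≡N) (≡.sym x≡0))
    in ¬xy (Adj-sym C (subst (Adj C y) succ-y≡x (Adj-succ y)))

  monochromaticCut : ∀ {x y} → toℕ x < toℕ y → ¬ Adj C x y →
                     ∃ λ D → VertexCut C D x y × Monochromatic C colour D
  monochromaticCut x<y ¬xy =
    let p , p+h<N , separated =
          separatingWindow 2≤h h+h≤N (nonadjacent⇒gap x<y ¬xy) (toℕ<n _) (nonadjacent⇒¬first-top ¬xy)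
    in Window.ends-monochromaticCut p p+h<N separated

  colour-mvd : IsMVDColoring C colour
  colour-mvd x y x≢y ¬xy with <-cmp (toℕ x) (toℕ y)
  ... | tri< x<y _ _ = monochromaticCut x<y ¬xy
  ... | tri≈ _ x≡y _ = ⊥-elim (x≢y (toℕ-injective x≡y))
  ... | tri> _ _ y<x with D , cut , mono ← monochromaticCut y<x (¬xy ∘ Adj-sym C) = D , VertexCut-sym C cut , mono

mvd-bound-attained : ∀ n → 4 ≤ n →
  ∃ λ (G : Graph n) → Hyp G × ∃ λ (c : Fin n → Fin (n / 2)) → UsesAllColors c × IsMVDColoring G c
mvd-bound-attained _ (s≤s (s≤s (s≤s (s≤s {n = m} z≤n)))) = C , C-hyp , colour , colour-surjective , colour-mvd
  where open Cycle m

theorem3p2 :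
    (∀ (n : ℕ) (G : Graph n) → Hyp G →
       ∀ (k : ℕ) (c : Fin n → Fin k) → UsesAllColors c → IsMVDColoring G c → k ≤ n / 2)
    × (∀ (n : ℕ) → 4 ≤ n →
       ∃ λ (G : Graph n) → Hyp G × ∃ λ (c : Fin n → Fin (n / 2)) → UsesAllColors c × IsMVDColoring G c)
theorem3p2 = (λ n G (2-conn , △-free , _) k → mvd-upperBound G 2-conn △-free) , mvd-bound-attained
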